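{- Let $G$ be a graph, let $v$ be a vertex of $G$, and let $X$ be a vertex cover of the graph $H_v$. Then there is a cluster deletion set $S$ of $G$ of minimum size such that either $v\notin S$ or $|X\setminus S|\geq 1+|\mathrm{Twins}(v)|$.
   Context: A graph is a cluster graph if every connected component is a clique; a set $S$ of vertices of $G$ is a cluster deletion set if $G-S$ is a cluster graph. For a vertex $v$ of $G$, let $N_1=N_G(v)$ be the set of neighbors of $v$ and $N_2$ the set of vertices at distance exactly $2$ from $v$. The graph $H_v$ has vertex set $N_1\cup N_2$; for $u\in N_1$, $u'\in N_2$, $(u,u')$ is an edge of $H_v$ iff it is an edge of $G$; for $u,u'\in N_1$, $(u,u')$ is an edge of $H_v$ iff it is not an edge of $G$; there are no edges between vertices of $N_2$. Vertices $v,v'$ are twins if $N[v]=N[v']$ (closed neighborhoods), and $\mathrm{Twins}(v)$ is the set consisting of $v$ and all its twins. A vertex cover of a graph is a set of vertices incident to every edge. -}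

module Defs where

open import Data.Nat using (ℕ; _≤_; _+_)
open import Data.Bool using (Bool; true; false; T; _∧_; _∨_)
open import Data.Bool.Properties using () renaming (_≟_ to _≟ᵇ_)
open import Data.Fin using (Fin; _≟_)
open import Data.Fin.Subset using (Subset; _∈_; _∉_; _─_; ∣_∣)
open import Data.Vec using (tabulate)
open import Data.List using (List; []; _∷_; allFin)
open import Data.Product using (_×_; ∃-syntax)
open import Data.Sum using (_⊎_)
open import Relation.Nullary using (¬_; does)
open import Relation.Binary.PropositionalEquality using (_≡_; _≢_)
open import Relation.Binary.Construct.Closure.ReflexiveTransitive using (Star)

allᵇ : {A : Set} → (A → Bool) → List A → Bool
allᵇ p [] = true
allᵇ p (x ∷ xs) = p x ∧ allᵇ p xs

record Graph (n : ℕ) : Set where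
  field
    edge    : Fin n → Fin n → Bool
    sym     : ∀ u w → edge u w ≡ edge w u
    irrefl  : ∀ u → edge u u ≡ false

module _ {n : ℕ} (G : Graph n) where
  open Graph G

  Adj : Fin n → Fin n → Set
  Adj u w = T (edge u w)

  AdjMinus : Subset n → Fin n → Fin n → Set
  AdjMinus S u w = u ∉ S × w ∉ S × Adj u w

  ConnectedMinus : Subset n → Fin n → Fin n → Set
  ConnectedMinus S = Star (AdjMinus S)

  IsClusterDeletionSet : Subset n → Set
  IsClusterDeletionSet S =
    ∀ u w → u ∉ S → w ∉ S → u ≢ w → ConnectedMinus S u w → Adj u w

  IsMinimumClusterDeletionSet : Subset n → Set
  IsMinimumClusterDeletionSet S =
    IsClusterDeletionSet S × (∀ T → IsClusterDeletionSet T → ∣ S ∣ ≤ ∣ T ∣)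

  InN1 : Fin n → Fin n → Set
  InN1 v u = Adj v u

  InN2 : Fin n → Fin n → Set
  InN2 v u = u ≢ v × ¬ Adj v u × ∃[ w ] (Adj v w × Adj w u)

  HEdge : Fin n → Fin n → Fin n → Set
  HEdge v u u' =
      (InN1 v u × InN2 v u' × Adj u u')
    ⊎ (InN2 v u × InN1 v u' × Adj u u')
    ⊎ (InN1 v u × InN1 v u' × u ≢ u' × ¬ Adj u u')

  IsVertexCoverH : Fin n → Subset n → Set
  IsVertexCoverH v X =
    (∀ u → u ∈ X → InN1 v u ⊎ InN2 v u) ×
    (∀ u u' → HEdge v u u' → u ∈ X ⊎ u' ∈ X)

  closedNbr : Fin n → Fin n → Bool
  closedNbr w x = does (w ≟ x) ∨ edge w x

  Twins : Fin n → Subset n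
  Twins v = tabulate (λ w → allᵇ (λ x → does (closedNbr w x ≟ᵇ closedNbr v x)) (allFin n))

-- A graph minus S is a cluster graph iff it has no induced path u – w – x.
-- Take a minimum cluster deletion set S with v ∈ S. Every twin of v lies in S,
-- for otherwise S - v would be smaller: v can join the clique of its twin.
-- If moreover |X ─ S| ≤ |Twins(v)|, then S' = (S ∪ X) ─ Twins(v) is no larger
-- than S and avoids v. It is again a cluster deletion set: in G − S' the closed
-- neighbourhood N[v] consists of Twins(v) and the vertices of N₁ outside S ∪ X;
-- the H_v-edges within N₁ are the non-edges of G, so these vertices form a
-- clique, and the H_v-edges from N₁ to N₂ are edges of G, so the clique has no
-- neighbours outside N[v]; off N[v], G − S' is a subgraph of G − S.
module Submission where

open import Defs
open import Data.Nat using (ℕ; _≤_; _+_; zero; suc; z≤n)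
open import Data.Nat.Properties
  using (module ≤-Reasoning; ≤-trans; ≤-reflexive; <⇒≱; ≰⇒>; _≤?_; +-suc; +-monoʳ-≤; +-cancelʳ-≤; ≤-pred)
open import Data.Fin using (Fin; _≟_)
open import Data.Fin.Properties using (all?)
open import Data.Fin.Subset using (Subset; _∈_; _∉_; _─_; _-_; _∪_; _⊆_; ⊤; ∣_∣; inside; outside)
open import Data.Fin.Subset.Properties
  using (_∈?_; anySubset?; ∈⊤; drop-∷-⊆; x∈p∪q⁺; x∈p∧x∉q⇒x∈p─q; x∈p∧x≢y⇒x∈p-y; x∈p⇒∣p-x∣<∣p∣)
open import Data.Bool using (Bool; T)
open import Data.Bool.Properties using (T-≡; T-∧; T-∨; T?) renaming (_≟_ to _≟ᵇ_)
open import Data.Vec using ([]; _∷_; tabulate; here; there)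
open import Data.Vec.Properties using ([]=⇒lookup; lookup⇒[]=; lookup∘tabulate)
open import Data.List using (List; []; _∷_; allFin)
open import Data.List.Relation.Unary.Any using () renaming (here to hereₗ; there to thereₗ)
open import Data.List.Membership.Propositional using () renaming (_∈_ to _∈ₗ_)
open import Data.List.Membership.Propositional.Properties using (∈-allFin)
open import Data.Product using (_×_; _,_; proj₁; proj₂; ∃-syntax)
open import Data.Sum using (_⊎_; inj₁; inj₂; [_,_])
open import Data.Empty using (⊥-elim)
open import Data.Unit using (tt)
open import Function.Bundles using (Equivalence)
open import Function using (_∘_)
open import Relation.Nullary using (¬_; Dec; yes; no; does; contradiction)
open import Relation.Nullary.Decidable using (dec-true; map′; ¬?; _→-dec_; _×-dec_)
open import Relation.Unary using (Pred; Decidable)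
open import Relation.Binary.PropositionalEquality using (_≡_; _≢_; refl; sym; trans; subst; cong)
open import Relation.Binary.Construct.Closure.ReflexiveTransitive using (ε; _◅_)

open Equivalence using (to; from)

variable
  n : ℕ

T-does⁺ : ∀ {A : Set} (a? : Dec A) → A → T (does a?)
T-does⁺ a? a = from T-≡ (dec-true a? a)

T-does⁻ : ∀ {A : Set} (a? : Dec A) → T (does a?) → A
T-does⁻ (yes a) _ = a

T-allᵇ⁻ : ∀ {A : Set} {p : A → Bool} {xs : List A} {x} → T (allᵇ p xs) → x ∈ₗ xs → T (p x)
T-allᵇ⁻ {xs = _ ∷ _} t (hereₗ refl) = proj₁ (to T-∧ t)
T-allᵇ⁻ {xs = _ ∷ _} t (thereₗ x∈xs) = T-allᵇ⁻ (proj₂ (to T-∧ t)) x∈xs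

T-allᵇ⁺ : ∀ {A : Set} {p : A → Bool} (xs : List A) → (∀ x → T (p x)) → T (allᵇ p xs)
T-allᵇ⁺ [] _ = tt
T-allᵇ⁺ (x ∷ xs) all-p = from T-∧ (all-p x , T-allᵇ⁺ xs all-p)

x∈tabulate⁻ : ∀ {f : Fin n → Bool} {x} → x ∈ tabulate f → T (f x)
x∈tabulate⁻ {f = f} {x = x} x∈ = from T-≡ (trans (sym (lookup∘tabulate f x)) ([]=⇒lookup x∈))

x∈tabulate⁺ : ∀ {f : Fin n → Bool} {x} → T (f x) → x ∈ tabulate f
x∈tabulate⁺ {f = f} {x = x} t = lookup⇒[]= x _ (trans (lookup∘tabulate f x) (to T-≡ t))

x∈p─q⇒x∉q : ∀ {p q : Subset n} {x} → x ∈ p ─ q → x ∉ q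
x∈p─q⇒x∉q {p = _ ∷ _} {inside ∷ _} () here
x∈p─q⇒x∉q {p = _ ∷ _} {_ ∷ _} (there x∈p─q) (there x∈q) = x∈p─q⇒x∉q x∈p─q x∈q

∣p∪q─r∣+∣r∣≡∣p∣+∣q─p∣ : ∀ (p q r : Subset n) → r ⊆ p → ∣ (p ∪ q) ─ r ∣ + ∣ r ∣ ≡ ∣ p ∣ + ∣ q ─ p ∣
∣p∪q─r∣+∣r∣≡∣p∣+∣q─p∣ [] [] [] _ = refl
∣p∪q─r∣+∣r∣≡∣p∣+∣q─p∣ (outside ∷ p) q (inside ∷ r) r⊆p = contradiction (r⊆p here) λ ()
∣p∪q─r∣+∣r∣≡∣p∣+∣q─p∣ (inside ∷ p) (_ ∷ q) (inside ∷ r) r⊆p =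
  trans (+-suc ∣ (p ∪ q) ─ r ∣ ∣ r ∣) (cong suc (∣p∪q─r∣+∣r∣≡∣p∣+∣q─p∣ p q r (drop-∷-⊆ r⊆p)))
∣p∪q─r∣+∣r∣≡∣p∣+∣q─p∣ (inside ∷ p) (_ ∷ q) (outside ∷ r) r⊆p =
  cong suc (∣p∪q─r∣+∣r∣≡∣p∣+∣q─p∣ p q r (drop-∷-⊆ r⊆p))
∣p∪q─r∣+∣r∣≡∣p∣+∣q─p∣ (outside ∷ p) (inside ∷ q) (outside ∷ r) r⊆p =
  trans (cong suc (∣p∪q─r∣+∣r∣≡∣p∣+∣q─p∣ p q r (drop-∷-⊆ r⊆p))) (sym (+-suc ∣ p ∣ ∣ q ─ p ∣))
∣p∪q─r∣+∣r∣≡∣p∣+∣q─p∣ (outside ∷ p) (outside ∷ q) (outside ∷ r) r⊆p =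
  ∣p∪q─r∣+∣r∣≡∣p∣+∣q─p∣ p q r (drop-∷-⊆ r⊆p)

minimum-exists : ∀ {ℓ} {P : Pred (Subset n) ℓ} → Decidable P → ∀ {S} → P S →
  ∃[ M ] (P M × (∀ T → P T → ∣ M ∣ ≤ ∣ T ∣))
minimum-exists {P = P} P? {S} PS = below ∣ S ∣ (S , PS , ≤-reflexive refl)
  where
  below : ∀ k → ∃[ S ] (P S × ∣ S ∣ ≤ k) → ∃[ M ] (P M × (∀ T → P T → ∣ M ∣ ≤ ∣ T ∣))
  below zero (S , PS , ∣S∣≤0) = S , PS , λ _ _ → ≤-trans ∣S∣≤0 z≤n
  below (suc k) (S , PS , ∣S∣≤1+k) with anySubset? (λ T → P? T ×-dec (∣ T ∣ ≤? k))
  ... | yes smaller = below k smaller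
  ... | no ¬smaller = S , PS , λ T PT → ≤-trans ∣S∣≤1+k (≰⇒> λ ∣T∣≤k → ¬smaller (T , PT , ∣T∣≤k))

module _ {n : ℕ} (G : Graph n) where
  open Graph G using (edge) renaming (sym to edge-sym)

  Adj-sym : ∀ {u w} → Adj G u w → Adj G w u
  Adj-sym {u} {w} = subst T (edge-sym u w)

  Adj? : ∀ u w → Dec (Adj G u w)
  Adj? u w = T? (edge u w)

  ClosedNbr : Fin n → Fin n → Set
  ClosedNbr v y = T (closedNbr G v y)

  ClosedNbr? : ∀ v y → Dec (ClosedNbr v y)
  ClosedNbr? v y = T? (closedNbr G v y)

  ClosedNbr-refl : ∀ v → ClosedNbr v v
  ClosedNbr-refl v = from T-∨ (inj₁ (T-does⁺ (v ≟ v) refl))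

  Adj⇒ClosedNbr : ∀ {v y} → Adj G v y → ClosedNbr v y
  Adj⇒ClosedNbr v~y = from T-∨ (inj₂ v~y)

  ClosedNbr⇒Adj : ∀ {v y} → ClosedNbr v y → v ≢ y → Adj G v y
  ClosedNbr⇒Adj {v} {y} y∈N[v] v≢y with to T-∨ y∈N[v]
  ... | inj₁ v≡y = contradiction (T-does⁻ (v ≟ y) v≡y) v≢y
  ... | inj₂ v~y = v~y

  Twins-refl : ∀ v → v ∈ Twins G v
  Twins-refl v = x∈tabulate⁺ (T-allᵇ⁺ (allFin n) λ x → T-does⁺ (closedNbr G v x ≟ᵇ closedNbr G v x) refl)

  closedNbr-twin : ∀ {v t} → t ∈ Twins G v → ∀ y → closedNbr G t y ≡ closedNbr G v y
  closedNbr-twin {v} {t} t∈ y = T-does⁻ (closedNbr G t y ≟ᵇ closedNbr G v y) (T-allᵇ⁻ (x∈tabulate⁻ t∈) (∈-allFin y))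

  ClosedNbr-fromTwin : ∀ {v t y} → t ∈ Twins G v → ClosedNbr t y → ClosedNbr v y
  ClosedNbr-fromTwin t∈ = subst T (closedNbr-twin t∈ _)

  ClosedNbr-toTwin : ∀ {v t y} → t ∈ Twins G v → ClosedNbr v y → ClosedNbr t y
  ClosedNbr-toTwin t∈ = subst T (sym (closedNbr-twin t∈ _))

  Adj-twin : ∀ {v t y} → t ∈ Twins G v → ClosedNbr v y → t ≢ y → Adj G t y
  Adj-twin t∈ y∈N[v] = ClosedNbr⇒Adj (ClosedNbr-toTwin t∈ y∈N[v])

  P₃Free : Subset n → Set
  P₃Free S = ∀ u w x → u ∉ S → w ∉ S → x ∉ S → Adj G u w → Adj G w x → u ≢ x → Adj G u x

  P₃Free? : Decidable P₃Free
  P₃Free? S = all? λ u → all? λ w → all? λ x →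
    ¬? (u ∈? S) →-dec ¬? (w ∈? S) →-dec ¬? (x ∈? S) →-dec
    Adj? u w →-dec Adj? w x →-dec ¬? (u ≟ x) →-dec Adj? u x

  ClusterDeletionSet⇒P₃Free : ∀ {S} → IsClusterDeletionSet G S → P₃Free S
  ClusterDeletionSet⇒P₃Free cds u w x u∉S w∉S x∉S u~w w~x u≢x =
    cds u x u∉S x∉S u≢x ((u∉S , w∉S , u~w) ◅ (w∉S , x∉S , w~x) ◅ ε)

  P₃Free⇒ClusterDeletionSet : ∀ {S} → P₃Free S → IsClusterDeletionSet G S
  P₃Free⇒ClusterDeletionSet {S} p₃ u w u∉S w∉S u≢w path with equal-or-adjacent path u∉S w∉S
    where
    equal-or-adjacent : ∀ {u w} → ConnectedMinus G S u w → u ∉ S → w ∉ S → u ≡ w ⊎ Adj G u w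
    equal-or-adjacent ε _ _ = inj₁ refl
    equal-or-adjacent {u} {w} ((_ , y∉S , u~y) ◅ path) u∉S w∉S with equal-or-adjacent path y∉S w∉S
    ... | inj₁ refl = inj₂ u~y
    ... | inj₂ y~w with u ≟ w
    ...   | yes u≡w = inj₁ u≡w
    ...   | no u≢w = inj₂ (p₃ u _ w u∉S y∉S w∉S u~y y~w u≢w)
  ... | inj₁ u≡w = contradiction u≡w u≢w
  ... | inj₂ u~w = u~w

  IsClusterDeletionSet? : Decidable (IsClusterDeletionSet G)
  IsClusterDeletionSet? S = map′ P₃Free⇒ClusterDeletionSet ClusterDeletionSet⇒P₃Free (P₃Free? S)

  minimumClusterDeletionSet : ∃[ S ] IsMinimumClusterDeletionSet G S
  minimumClusterDeletionSet =
    minimum-exists IsClusterDeletionSet? {⊤} λ u _ u∉⊤ _ _ _ → contradiction ∈⊤ u∉⊤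

  ClosedNbr-clique : ∀ {S t a b} → P₃Free S → t ∉ S → a ∉ S → b ∉ S →
    ClosedNbr t a → ClosedNbr t b → a ≢ b → Adj G a b
  ClosedNbr-clique {t = t} {a} {b} p₃ t∉S a∉S b∉S a∈N[t] b∈N[t] a≢b with a ≟ t | b ≟ t
  ... | yes refl | _ = ClosedNbr⇒Adj b∈N[t] a≢b
  ... | no _ | yes refl = Adj-sym (ClosedNbr⇒Adj a∈N[t] (a≢b ∘ sym))
  ... | no a≢t | no b≢t =
    p₃ a t b a∉S t∉S b∉S (Adj-sym (ClosedNbr⇒Adj a∈N[t] (a≢t ∘ sym))) (ClosedNbr⇒Adj b∈N[t] (b≢t ∘ sym)) a≢b

  ClosedNbr-closed : ∀ {S t c y} → P₃Free S → t ∉ S → c ∉ S → y ∉ S →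
    ClosedNbr t c → Adj G c y → ClosedNbr t y
  ClosedNbr-closed {t = t} {c} {y} p₃ t∉S c∉S y∉S c∈N[t] c~y with c ≟ t | y ≟ t
  ... | yes refl | _ = Adj⇒ClosedNbr c~y
  ... | no _ | yes refl = ClosedNbr-refl t
  ... | no c≢t | no y≢t =
    Adj⇒ClosedNbr (p₃ t c y t∉S c∉S y∉S (ClosedNbr⇒Adj c∈N[t] (c≢t ∘ sym)) c~y (y≢t ∘ sym))

  P₃Free-cliqueComponent : ∀ {ℓ} {S S'} {C : Pred (Fin n) ℓ} → Decidable C → P₃Free S →
    (∀ {y} → y ∉ S' → ¬ C y → y ∉ S) →
    (∀ {a b} → a ∉ S' → b ∉ S' → C a → C b → a ≢ b → Adj G a b) →
    (∀ {c y} → c ∉ S' → y ∉ S' → C c → Adj G c y → C y) →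
    P₃Free S'
  P₃Free-cliqueComponent {C = C} C? p₃ avoids-S clique closed u w x u∉ w∉ x∉ u~w w~x u≢x with C? w
  ... | yes Cw = clique u∉ x∉ (closed w∉ u∉ Cw (Adj-sym u~w)) (closed w∉ x∉ Cw w~x) u≢x
  ... | no ¬Cw = p₃ u w x (avoids-S u∉ ¬Cu) (avoids-S w∉ ¬Cw) (avoids-S x∉ ¬Cx) u~w w~x u≢x
    where
    ¬Cu : ¬ C u
    ¬Cu Cu = ¬Cw (closed u∉ w∉ Cu u~w)
    ¬Cx : ¬ C x
    ¬Cx Cx = ¬Cw (closed x∉ w∉ Cx (Adj-sym w~x))

  P₃Free-removeTwin : ∀ {S v t} → P₃Free S → t ∈ Twins G v → t ∉ S → P₃Free (S - v)
  P₃Free-removeTwin {S} {v} {t} p₃ t∈Tw t∉S = P₃Free-cliqueComponent (ClosedNbr? v) p₃ avoids-S clique closed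
    where
    v-or-∉S : ∀ {y} → y ∉ S - v → y ≡ v ⊎ y ∉ S
    v-or-∉S {y} y∉ with y ≟ v
    ... | yes y≡v = inj₁ y≡v
    ... | no y≢v = inj₂ λ y∈S → y∉ (x∈p∧x≢y⇒x∈p-y y∈S y≢v)

    avoids-S : ∀ {y} → y ∉ S - v → ¬ ClosedNbr v y → y ∉ S
    avoids-S y∉ y∉N[v] with v-or-∉S y∉
    ... | inj₁ refl = contradiction (ClosedNbr-refl v) y∉N[v]
    ... | inj₂ y∉S = y∉S

    clique : ∀ {a b} → a ∉ S - v → b ∉ S - v → ClosedNbr v a → ClosedNbr v b → a ≢ b → Adj G a b
    clique a∉ b∉ a∈N[v] b∈N[v] a≢b with v-or-∉S a∉ | v-or-∉S b∉
    ... | inj₁ refl | _ = ClosedNbr⇒Adj b∈N[v] a≢b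
    ... | inj₂ _ | inj₁ refl = Adj-sym (ClosedNbr⇒Adj a∈N[v] (a≢b ∘ sym))
    ... | inj₂ a∉S | inj₂ b∉S =
      ClosedNbr-clique p₃ t∉S a∉S b∉S (ClosedNbr-toTwin t∈Tw a∈N[v]) (ClosedNbr-toTwin t∈Tw b∈N[v]) a≢b

    closed : ∀ {c y} → c ∉ S - v → y ∉ S - v → ClosedNbr v c → Adj G c y → ClosedNbr v y
    closed c∉ y∉ c∈N[v] c~y with v-or-∉S c∉ | v-or-∉S y∉
    ... | inj₁ refl | _ = Adj⇒ClosedNbr c~y
    ... | inj₂ _ | inj₁ refl = ClosedNbr-refl v
    ... | inj₂ c∉S | inj₂ y∉S =
      ClosedNbr-fromTwin t∈Tw (ClosedNbr-closed p₃ t∉S c∉S y∉S (ClosedNbr-toTwin t∈Tw c∈N[v]) c~y)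

  Twins⊆minimum : ∀ {S v} → IsMinimumClusterDeletionSet G S → v ∈ S → Twins G v ⊆ S
  Twins⊆minimum {S} {v} (cds , minimal) v∈S {t} t∈Tw with t ∈? S
  ... | yes t∈S = t∈S
  ... | no t∉S = contradiction (minimal (S - v) S-v-cds) (<⇒≱ (x∈p⇒∣p-x∣<∣p∣ v∈S))
    where
    S-v-cds : IsClusterDeletionSet G (S - v)
    S-v-cds = P₃Free⇒ClusterDeletionSet (P₃Free-removeTwin (ClusterDeletionSet⇒P₃Free cds) t∈Tw t∉S)

  uncovered-N₁-clique : ∀ {v X a b} → IsVertexCoverH G v X → a ∉ X → b ∉ X →
    Adj G v a → Adj G v b → a ≢ b → Adj G a b
  uncovered-N₁-clique (_ , covers) a∉X b∉X v~a v~b a≢b with Adj? _ _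
  ... | yes a~b = a~b
  ... | no a≁b = ⊥-elim ([ a∉X , b∉X ] (covers _ _ (inj₂ (inj₂ (v~a , v~b , a≢b , a≁b)))))

  uncovered-N₁-N₂ : ∀ {v X c y} → IsVertexCoverH G v X → c ∉ X → y ∉ X → y ≢ v →
    Adj G v c → Adj G c y → Adj G v y
  uncovered-N₁-N₂ {v} {c = c} {y} (_ , covers) c∉X y∉X y≢v v~c c~y with Adj? v y
  ... | yes v~y = v~y
  ... | no v≁y = ⊥-elim ([ c∉X , y∉X ] (covers c y (inj₁ (v~c , (y≢v , v≁y , c , v~c , c~y) , c~y))))

  P₃Free-replaceTwins : ∀ {S v X} → P₃Free S → Twins G v ⊆ S → IsVertexCoverH G v X →
    P₃Free ((S ∪ X) ─ Twins G v)
  P₃Free-replaceTwins {S} {v} {X} p₃ Tw⊆S cover =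
    P₃Free-cliqueComponent (ClosedNbr? v) p₃ avoids-S clique closed
    where
    S' = (S ∪ X) ─ Twins G v

    twin-or-∉S∪X : ∀ {y} → y ∉ S' → y ∈ Twins G v ⊎ (y ∉ S × y ∉ X)
    twin-or-∉S∪X {y} y∉ with y ∈? Twins G v
    ... | yes y∈Tw = inj₁ y∈Tw
    ... | no y∉Tw = inj₂ ( (λ y∈S → y∉ (x∈p∧x∉q⇒x∈p─q (x∈p∪q⁺ (inj₁ y∈S)) y∉Tw))
                         , (λ y∈X → y∉ (x∈p∧x∉q⇒x∈p─q (x∈p∪q⁺ (inj₂ y∈X)) y∉Tw)))

    ≢-outside : ∀ {y} → y ∉ S → v ≢ y
    ≢-outside y∉S refl = y∉S (Tw⊆S (Twins-refl v))

    avoids-S : ∀ {y} → y ∉ S' → ¬ ClosedNbr v y → y ∉ S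
    avoids-S y∉ y∉N[v] with twin-or-∉S∪X y∉
    ... | inj₁ y∈Tw = contradiction (ClosedNbr-fromTwin y∈Tw (ClosedNbr-refl _)) y∉N[v]
    ... | inj₂ (y∉S , _) = y∉S

    clique : ∀ {a b} → a ∉ S' → b ∉ S' → ClosedNbr v a → ClosedNbr v b → a ≢ b → Adj G a b
    clique a∉ b∉ a∈N[v] b∈N[v] a≢b with twin-or-∉S∪X a∉ | twin-or-∉S∪X b∉
    ... | inj₁ a∈Tw | _ = Adj-twin a∈Tw b∈N[v] a≢b
    ... | inj₂ _ | inj₁ b∈Tw = Adj-sym (Adj-twin b∈Tw a∈N[v] (a≢b ∘ sym))
    ... | inj₂ (a∉S , a∉X) | inj₂ (b∉S , b∉X) = uncovered-N₁-clique cover a∉X b∉X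
      (ClosedNbr⇒Adj a∈N[v] (≢-outside a∉S)) (ClosedNbr⇒Adj b∈N[v] (≢-outside b∉S)) a≢b

    closed : ∀ {c y} → c ∉ S' → y ∉ S' → ClosedNbr v c → Adj G c y → ClosedNbr v y
    closed c∉ y∉ c∈N[v] c~y with twin-or-∉S∪X c∉ | twin-or-∉S∪X y∉
    ... | inj₁ c∈Tw | _ = ClosedNbr-fromTwin c∈Tw (Adj⇒ClosedNbr c~y)
    ... | inj₂ _ | inj₁ y∈Tw = ClosedNbr-fromTwin y∈Tw (ClosedNbr-refl _)
    ... | inj₂ (c∉S , c∉X) | inj₂ (y∉S , y∉X) = Adj⇒ClosedNbr (uncovered-N₁-N₂ cover c∉X y∉X
      (≢-outside y∉S ∘ sym) (ClosedNbr⇒Adj c∈N[v] (≢-outside c∉S)) c~y)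

  replaceTwins-minimum : ∀ {S v X} → IsMinimumClusterDeletionSet G S → v ∈ S →
    IsVertexCoverH G v X → ∣ X ─ S ∣ ≤ ∣ Twins G v ∣ →
    IsMinimumClusterDeletionSet G ((S ∪ X) ─ Twins G v)
  replaceTwins-minimum {S} {v} {X} minimum@(cds , minimal) v∈S cover ∣X─S∣≤∣Tw∣ =
    P₃Free⇒ClusterDeletionSet (P₃Free-replaceTwins (ClusterDeletionSet⇒P₃Free cds) Tw⊆S cover) ,
    λ T cdsT → ≤-trans ∣S'∣≤∣S∣ (minimal T cdsT)
    where
    Tw⊆S : Twins G v ⊆ S
    Tw⊆S = Twins⊆minimum minimum v∈S

    ∣S'∣≤∣S∣ : ∣ (S ∪ X) ─ Twins G v ∣ ≤ ∣ S ∣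
    ∣S'∣≤∣S∣ = +-cancelʳ-≤ ∣ Twins G v ∣ _ _ (begin
      ∣ (S ∪ X) ─ Twins G v ∣ + ∣ Twins G v ∣ ≡⟨ ∣p∪q─r∣+∣r∣≡∣p∣+∣q─p∣ S X (Twins G v) Tw⊆S ⟩
      ∣ S ∣ + ∣ X ─ S ∣                       ≤⟨ +-monoʳ-≤ ∣ S ∣ ∣X─S∣≤∣Tw∣ ⟩
      ∣ S ∣ + ∣ Twins G v ∣                   ∎)
      where open ≤-Reasoning

mainTheorem3 : ∀ {n : ℕ} (G : Graph n) (v : Fin n) (X : Subset n) →
    IsVertexCoverH G v X →
    ∃[ S ] (IsMinimumClusterDeletionSet G S ×
    (v ∉ S ⊎ 1 + ∣ Twins G v ∣ ≤ ∣ X ─ S ∣))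
mainTheorem3 G v X cover with minimumClusterDeletionSet G
... | S , minimum with v ∈? S
...   | no v∉S = S , minimum , inj₁ v∉S
...   | yes v∈S with 1 + ∣ Twins G v ∣ ≤? ∣ X ─ S ∣
...     | yes large = S , minimum , inj₂ large
...     | no ¬large =
  (S ∪ X) ─ Twins G v ,
  replaceTwins-minimum G minimum v∈S cover (≤-pred (≰⇒> ¬large)) ,
  inj₁ (λ v∈S' → x∈p─q⇒x∉q v∈S' (Twins-refl G v))
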